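{- Let $K_{n_1,n_2}$ be the complete bipartite graph with $n_2\geq n_1 \geq 2$. Then $$\gamma_t(M(K_{n_1,n_2}))= \begin{cases} n_2+\left\lceil\frac{2n_1-n_2}{3}\right\rceil & \text{if } n_1\le n_2\le 2n_1-1,\\ n_2 & \text{if } n_2\ge 2n_1. \end{cases}$$
   Context: All graphs are finite and simple. $K_{n_1,n_2}$ is the complete bipartite graph with parts of sizes $n_1$ and $n_2$. For a graph $H$ with no isolated vertices, a total dominating set of $H$ is a set $S\subseteq V(H)$ such that every vertex of $H$ has at least one neighbor in $S$; $\gamma_t(H)$ is the minimum cardinality of a total dominating set. The middle graph $M(G)$ of a graph $G$ has vertex set $V(G)\cup E(G)$ (disjoint union), and two of its vertices $x,y$ are adjacent exactly when either $x,y\in E(G)$ are edges of $G$ sharing a common endpoint, or $x\in V(G)$, $y\in E(G)$ and $x$ is an endpoint of $y$ (no two elements of $V(G)$ are adjacent in $M(G)$). -}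

module Defs where

open import Data.Nat using (ℕ; zero; suc; _+_; _*_; _∸_; _≤_; _<_; _<ᵇ_)
open import Data.Nat.DivMod using (_/_)
open import Data.Fin using (Fin; toℕ) renaming (_<_ to _<F_)
open import Data.Bool using (Bool; true; false; T; _xor_)
open import Data.Product using (Σ; Σ-syntax; ∃; ∃-syntax; _×_; _,_; proj₁; proj₂)
open import Data.Sum using (_⊎_; inj₁; inj₂)
open import Data.Empty using (⊥)
open import Data.List using (List; length)
open import Data.List.Membership.Propositional using (_∈_)
open import Data.List.Relation.Unary.Unique.Propositional using (Unique)
open import Relation.Binary.PropositionalEquality using (_≡_; _≢_; refl)

record SimpleGraph (n : ℕ) : Set where
  field
    adj    : Fin n → Fin n → Bool
    sym    : ∀ u v → adj u v ≡ adj v u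
    irrefl : ∀ u → adj u u ≡ false
open SimpleGraph public

-- Edges of G: unordered pairs {u , v}, represented canonically with u < v.
Edge : ∀ {n} → SimpleGraph n → Set
Edge {n} G = Σ[ u ∈ Fin n ] Σ[ v ∈ Fin n ] (u <F v × T (adj G u v))

Incident : ∀ {n} {G : SimpleGraph n} → Fin n → Edge G → Set
Incident x (u , v , _) = (x ≡ u) ⊎ (x ≡ v)

record Graph : Set₁ where
  field
    V   : Set
    Adj : V → V → Set
open Graph public

MAdj : ∀ {n} (G : SimpleGraph n) → (Fin n ⊎ Edge G) → (Fin n ⊎ Edge G) → Set
MAdj G (inj₁ x) (inj₁ y) = ⊥
MAdj G (inj₁ x) (inj₂ e) = Incident {G = G} x e
MAdj G (inj₂ e) (inj₁ x) = Incident {G = G} x e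
MAdj {n} G (inj₂ e) (inj₂ f) = (e ≢ f) × (Σ[ x ∈ Fin n ] (Incident {G = G} x e × Incident {G = G} x f))

Middle : ∀ {n} → SimpleGraph n → Graph
Middle {n} G = record { V = Fin n ⊎ Edge G ; Adj = MAdj G }

private
  xor-self : ∀ b → b xor b ≡ false
  xor-self true = refl
  xor-self false = refl

  xor-comm : ∀ a b → a xor b ≡ b xor a
  xor-comm true true = refl
  xor-comm true false = refl
  xor-comm false true = refl
  xor-comm false false = refl

K : (n1 n2 : ℕ) → SimpleGraph (n1 + n2)
K n1 n2 = record
  { adj    = λ i j → (toℕ i <ᵇ n1) xor (toℕ j <ᵇ n1)
  ; sym    = λ i j → xor-comm (toℕ i <ᵇ n1) (toℕ j <ᵇ n1)
  ; irrefl = λ i → xor-self (toℕ i <ᵇ n1)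
  }

IsTDS : (H : Graph) → List (V H) → Set
IsTDS H S = ∀ v → Σ[ u ∈ V H ] (u ∈ S × Adj H v u)

TotalDominationNumber : Graph → ℕ → Set
TotalDominationNumber H k =
  (Σ[ S ∈ List (V H) ] (Unique S × IsTDS H S × length S ≡ k)) ×
  (∀ (S : List (V H)) → Unique S → IsTDS H S → k ≤ length S)

ceil3 : ℕ → ℕ
ceil3 m = (m + 2) / 3

-- A total dominating set S of a middle graph contains an edge at every vertex, and every edge of S
-- needs a neighbour in S. Charging two tokens per vertex to elements of S, at most three per element,
-- gives 2|V| ≤ 3|S|; and since an edge of K n₁ n₂ meets just one vertex of the n₂-side, n₂ ≤ |S|.
-- Together these give |S| ≥ n₂ + ⌈(2n₁ − n₂)/3⌉, resp. |S| ≥ n₂. Conversely, viewing the edges of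
-- K n₁ n₂ as the cells of an n₁ × n₂ grid, any set of cells meeting every row and column, in which every
-- cell shares a row or a column with another one, is total dominating; dominoes give one of that size.
{-# OPTIONS --safe #-}
module Submission where

open import Defs hiding (sym)
open import Data.Bool using (true; false; T; _xor_)
open import Data.Bool.Properties using (T-irrelevant)
open import Data.Empty using (⊥; ⊥-elim)
open import Data.Fin as Fin using (Fin; zero; suc; toℕ; _↑ˡ_; _↑ʳ_; splitAt; combine; remQuot)
open import Data.Fin.Patterns using (0F; 1F; 2F)
import Data.Fin.Properties as Fin
open import Data.List using (List; length; lookup; tabulate)
open import Data.List.Properties using (length-tabulate)
open import Data.List.Membership.Propositional using (_∈_; lose; find)
open import Data.List.Membership.Propositional.Properties using (∈-tabulate⁺)
open import Data.List.Relation.Unary.Any as Any using (Any; any?)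
open import Data.List.Relation.Unary.Any.Properties using (lookup-index)
open import Data.List.Relation.Unary.Unique.Propositional using (Unique)
open import Data.List.Relation.Unary.Unique.Propositional.Properties using (tabulate⁺)
open import Data.Nat using (ℕ; zero; suc; _+_; _*_; _∸_; _≤_; _<_; _<ᵇ_; z≤n; s≤s; s≤s⁻¹)
open import Data.Nat.DivMod using (_%_; m/n*n≤m; m≡m%n+[m/n]*n; m%n<n; m<n*o⇒m/o<n)
open import Data.Nat.Properties
open import Data.Nat.Tactic.RingSolver using (solve-∀)
open import Data.Product using (Σ-syntax; ∃-syntax; _×_; _,_; proj₁; proj₂; uncurry)
open import Data.Sum using (_⊎_; inj₁; inj₂)
open import Data.Sum.Function.Propositional using (_⊎-↔_)
open import Data.Sum.Properties using (inj₂-injective)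
open import Data.Unit using (tt)
open import Function using (_∘_; Injective)
open import Function.Bundles using (_↔_; Inverse; Injection)
open import Function.Construct.Composition using (_↔-∘_)
open import Function.Construct.Identity using (↔-id)
open import Function.Properties.Inverse using (↔⇒↣; ↔-sym)
open import Relation.Nullary using (¬_; Dec; yes; no)
open import Relation.Nullary.Decidable using (_⊎-dec_; _×-dec_; ¬?)
open import Relation.Binary.PropositionalEquality

∈-index-injective : ∀ {A : Set} {xs : List A} {x y} (p : x ∈ xs) (q : y ∈ xs) →
                    Any.index p ≡ Any.index q → x ≡ y
∈-index-injective {xs = xs} p q eq =
  trans (lookup-index p) (trans (cong (lookup xs) eq) (sym (lookup-index q)))

↔-injective : ∀ {A B : Set} (e : A ↔ B) → Injective _≡_ _≡_ (Inverse.to e)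
↔-injective e = Injection.injective (↔⇒↣ e)

×-injective⇒≤ : ∀ {m k n l} {f : Fin m × Fin k → Fin n × Fin l} → Injective _≡_ _≡_ f → m * k ≤ n * l
×-injective⇒≤ {m} {k} {n} {l} {f} f-inj = Fin.injective⇒≤ {f = uncurry combine ∘ f ∘ remQuot {m} k}
  (↔-injective (Fin.*↔× {m} {k}) ∘ f-inj ∘ ↔-injective (↔-sym (Fin.*↔× {n} {l})))

module Edges {n} (G : SimpleGraph n) where

  src tgt : Edge G → Fin n
  src = proj₁
  tgt = proj₁ ∘ proj₂

  Inc : Fin n → Edge G → Set
  Inc = Incident {G = G}

  edge-ext : ∀ {e f : Edge G} → src e ≡ src f → tgt e ≡ tgt f → e ≡ f
  edge-ext {u , w , p , t} {_ , _ , p′ , t′} refl refl =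
    cong₂ (λ p t → u , w , p , t) (Fin.<-irrelevant p p′) (T-irrelevant t t′)

  _≟ₑ_ : (e f : Edge G) → Dec (e ≡ f)
  e ≟ₑ f with src e Fin.≟ src f | tgt e Fin.≟ tgt f
  ... | yes p  | yes q = yes (edge-ext p q)
  ... | no ¬p  | _     = no (¬p ∘ cong src)
  ... | yes _  | no ¬q = no (¬q ∘ cong tgt)

  incident? : ∀ x e → Dec (Inc x e)
  incident? x e = (x Fin.≟ src e) ⊎-dec (x Fin.≟ tgt e)

  incident-nonadjacent : ∀ {x y} {e : Edge G} → adj G x y ≡ false → Inc x e → Inc y e → x ≡ y
  incident-nonadjacent {e = _ , _ , _ , t} x≁y (inj₁ refl) (inj₂ refl) = ⊥-elim (subst T x≁y t)
  incident-nonadjacent {x} {y} {e = _ , _ , _ , t} x≁y (inj₂ refl) (inj₁ refl) =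
    ⊥-elim (subst T (trans (SimpleGraph.sym G y x) x≁y) t)
  incident-nonadjacent _ (inj₁ refl) (inj₁ refl) = refl
  incident-nonadjacent _ (inj₂ refl) (inj₂ refl) = refl

module MiddleTDS {n} (G : SimpleGraph n) (S : List (Fin n ⊎ Edge G)) (tds : IsTDS (Middle G) S) where

  open Edges G

  coveringEdge : ∀ v → ∃[ e ] (inj₂ e ∈ S × Inc v e)
  coveringEdge v with tds (inj₁ v)
  ... | inj₂ e , e∈S , v∈e = e , e∈S , v∈e

  edgeAt : Fin n → Edge G
  edgeAt = proj₁ ∘ coveringEdge

  edgeAt∈S : ∀ v → inj₂ (edgeAt v) ∈ S
  edgeAt∈S = proj₁ ∘ proj₂ ∘ coveringEdge

  edgeAt-incident : ∀ v → Inc v (edgeAt v)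
  edgeAt-incident = proj₂ ∘ proj₂ ∘ coveringEdge

  EdgeAtBesides : Fin n → Edge G → Fin n ⊎ Edge G → Set
  EdgeAtBesides v e (inj₁ _) = ⊥
  EdgeAtBesides v e (inj₂ f) = Inc v f × f ≢ e

  AnotherEdge : Fin n → Edge G → Set
  AnotherEdge v e = Any (EdgeAtBesides v e) S

  anotherEdge? : ∀ v e → Dec (AnotherEdge v e)
  anotherEdge? v e = any? decide S
    where
      decide : ∀ s → Dec (EdgeAtBesides v e s)
      decide (inj₁ _) = no λ ()
      decide (inj₂ f) = incident? v f ×-dec ¬? (f ≟ₑ e)

  anotherEdge : ∀ {v e f} → inj₂ f ∈ S → Inc v f → f ≢ e → AnotherEdge v e
  anotherEdge f∈S v∈f f≢e = lose f∈S (v∈f , f≢e)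

  anotherEdge⁻ : ∀ {v e} → AnotherEdge v e → ∃[ f ] (inj₂ f ∈ S × Inc v f × f ≢ e)
  anotherEdge⁻ a with find a
  ... | inj₂ f , f∈S , v∈f , f≢e = f , f∈S , v∈f , f≢e

  isolatedEdge-dominator : ∀ e → ¬ AnotherEdge (src e) e → ¬ AnotherEdge (tgt e) e →
                           ∃[ x ] (inj₁ x ∈ S × Inc x e)
  isolatedEdge-dominator e ¬src ¬tgt with tds (inj₂ e)
  ... | inj₁ x , x∈S , x∈e = x , x∈S , x∈e
  ... | inj₂ f , f∈S , e≢f , x , inj₁ refl , x∈f = ⊥-elim (¬src (anotherEdge f∈S x∈f (e≢f ∘ sym)))
  ... | inj₂ f , f∈S , e≢f , x , inj₂ refl , x∈f = ⊥-elim (¬tgt (anotherEdge f∈S x∈f (e≢f ∘ sym)))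

  -- Every vertex v gives two tokens t to elements of S, each element taking at most one token per slot k.
  -- Token 0 goes to edgeAt v; token 1 to another edge of S at v if there is one, and otherwise to slot 2
  -- of edgeAt v, unless that edge meets no other edge of S and v is its target (its source has the
  -- slot): then it goes to a vertex of S dominating the edge. Slots 0 and 1 of an edge separate its
  -- source from its target.
  data Charge : Fin n → Fin 2 → Fin n ⊎ Edge G → Fin 3 → Set where
    edgeAt-src : ∀ {v e} → v ≡ src e → edgeAt v ≡ e → Charge v 0F (inj₂ e) 0F
    edgeAt-tgt : ∀ {v e} → v ≡ tgt e → edgeAt v ≡ e → Charge v 0F (inj₂ e) 1F
    other-src  : ∀ {v e} → v ≡ src e → e ≢ edgeAt v → Charge v 1F (inj₂ e) 0F
    other-tgt  : ∀ {v e} → v ≡ tgt e → e ≢ edgeAt v → Charge v 1F (inj₂ e) 1F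
    lonely     : ∀ {v e} → edgeAt v ≡ e → ¬ AnotherEdge v e →
                 v ≡ src e ⊎ (v ≡ tgt e × AnotherEdge (src e) e) → Charge v 1F (inj₂ e) 2F
    isolated   : ∀ {v e x} → edgeAt v ≡ e → v ≡ tgt e → ¬ AnotherEdge (src e) e → ¬ AnotherEdge v e →
                 Inc x e → Charge v 1F (inj₁ x) 0F

  record Charged (v : Fin n) (t : Fin 2) : Set where
    constructor charged
    field
      {target} : Fin n ⊎ Edge G
      target∈S : target ∈ S
      slot     : Fin 3
      reason   : Charge v t target slot

  charge : ∀ v t → Charged v t
  charge v 0F with edgeAt-incident v
  ... | inj₁ v≡src = charged (edgeAt∈S v) 0F (edgeAt-src v≡src refl)
  ... | inj₂ v≡tgt = charged (edgeAt∈S v) 1F (edgeAt-tgt v≡tgt refl)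
  charge v 1F with anotherEdge? v (edgeAt v)
  ... | yes another with anotherEdge⁻ another
  ...   | f , f∈S , inj₁ v≡src , f≢edgeAt = charged f∈S 0F (other-src v≡src f≢edgeAt)
  ...   | f , f∈S , inj₂ v≡tgt , f≢edgeAt = charged f∈S 1F (other-tgt v≡tgt f≢edgeAt)
  charge v 1F | no ¬another with edgeAt-incident v
  ... | inj₁ v≡src = charged (edgeAt∈S v) 2F (lonely refl ¬another (inj₁ v≡src))
  ... | inj₂ v≡tgt with anotherEdge? (src (edgeAt v)) (edgeAt v)
  ...   | yes another = charged (edgeAt∈S v) 2F (lonely refl ¬another (inj₂ (v≡tgt , another)))
  ...   | no ¬another′ with isolatedEdge-dominator (edgeAt v) ¬another′
                                   (subst (λ z → ¬ AnotherEdge z (edgeAt v)) v≡tgt ¬another)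
  ...     | x , x∈S , x∈e = charged x∈S 0F (isolated refl v≡tgt ¬another′ ¬another x∈e)

  private
    edgeAt-transport : ∀ {v w e} → v ≡ w → edgeAt v ≡ e → e ≡ edgeAt w
    edgeAt-transport v≡w edgeAt≡e = trans (sym edgeAt≡e) (cong edgeAt v≡w)

    edgeAt≡⇒∈S : ∀ {v e} → edgeAt v ≡ e → inj₂ e ∈ S
    edgeAt≡⇒∈S {v} refl = edgeAt∈S v

  charge-unique : ∀ {v v′ t t′ s k} → Charge v t s k → Charge v′ t′ s k → v ≡ v′ × t ≡ t′
  charge-unique (edgeAt-src p _) (edgeAt-src p′ _) = trans p (sym p′) , refl
  charge-unique (edgeAt-tgt p _) (edgeAt-tgt p′ _) = trans p (sym p′) , refl
  charge-unique (other-src p _) (other-src p′ _) = trans p (sym p′) , refl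
  charge-unique (other-tgt p _) (other-tgt p′ _) = trans p (sym p′) , refl
  charge-unique (edgeAt-src p r) (other-src p′ e≢) = ⊥-elim (e≢ (edgeAt-transport (trans p (sym p′)) r))
  charge-unique (edgeAt-tgt p r) (other-tgt p′ e≢) = ⊥-elim (e≢ (edgeAt-transport (trans p (sym p′)) r))
  charge-unique (other-src p e≢) (edgeAt-src p′ r) = ⊥-elim (e≢ (edgeAt-transport (trans p′ (sym p)) r))
  charge-unique (other-tgt p e≢) (edgeAt-tgt p′ r) = ⊥-elim (e≢ (edgeAt-transport (trans p′ (sym p)) r))
  charge-unique (lonely _ _ (inj₁ p)) (lonely _ _ (inj₁ p′)) = trans p (sym p′) , refl
  charge-unique (lonely _ _ (inj₂ (p , _))) (lonely _ _ (inj₂ (p′ , _))) = trans p (sym p′) , refl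
  charge-unique (lonely _ ¬another (inj₁ refl)) (lonely _ _ (inj₂ (_ , another))) = ⊥-elim (¬another another)
  charge-unique (lonely _ _ (inj₂ (_ , another))) (lonely _ ¬another (inj₁ refl)) = ⊥-elim (¬another another)
  charge-unique (isolated {e = e} r p ¬src ¬v x∈e) (isolated {e = e′} r′ p′ _ _ x∈e′) with e ≟ₑ e′
  ... | yes refl = trans p (sym p′) , refl
  ... | no e≢e′ with x∈e
  ...   | inj₁ refl = ⊥-elim (¬src (anotherEdge (edgeAt≡⇒∈S r′) x∈e′ (e≢e′ ∘ sym)))
  ...   | inj₂ refl =
          ⊥-elim (¬v (anotherEdge (edgeAt≡⇒∈S r′) (subst (λ z → Inc z e′) (sym p) x∈e′)
                                  (e≢e′ ∘ sym)))

  chargeSlot : Fin n × Fin 2 → Fin (length S) × Fin 3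
  chargeSlot (v , t) = Any.index (Charged.target∈S c) , Charged.slot c
    where c = charge v t

  chargeSlot-injective : Injective _≡_ _≡_ chargeSlot
  chargeSlot-injective {v , t} {v′ , t′} eq with charge v t | charge v′ t′
  ... | charged p _ c | charged p′ _ c′ with ∈-index-injective p p′ (cong proj₁ eq) | cong proj₂ eq
  ...   | refl | refl with charge-unique c c′
  ...     | refl , refl = refl

  n*2≤length*3 : n * 2 ≤ length S * 3
  n*2≤length*3 = ×-injective⇒≤ chargeSlot-injective

  independent⇒≤length : ∀ {k} (ι : Fin k → Fin n) → Injective _≡_ _≡_ ι →
                        (∀ i j → adj G (ι i) (ι j) ≡ false) → k ≤ length S
  independent⇒≤length ι ι-inj independent = Fin.injective⇒≤ {f = Any.index ∘ edgeAt∈S ∘ ι} λ {i} {j} eq →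
    let same = inj₂-injective (∈-index-injective (edgeAt∈S (ι j)) (edgeAt∈S (ι i)) (sym eq))
    in ι-inj (incident-nonadjacent {e = edgeAt (ι i)} (independent i j) (edgeAt-incident (ι i))
                                   (subst (Inc (ι j)) same (edgeAt-incident (ι j))))

data Side (a b : ℕ) : Fin (a + b) → Set where
  left  : (r : Fin a) → Side a b (r ↑ˡ b)
  right : (c : Fin b) → Side a b (a ↑ʳ c)

side : ∀ a b (v : Fin (a + b)) → Side a b v
side a b v with splitAt a v in eq
... | inj₁ r = subst (Side a b) (Fin.splitAt⁻¹-↑ˡ eq) (left r)
... | inj₂ c = subst (Side a b) (Fin.splitAt⁻¹-↑ʳ eq) (right c)

↑ˡ≢↑ʳ : ∀ {m n} (i : Fin m) (j : Fin n) → i ↑ˡ n ≢ m ↑ʳ j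
↑ˡ≢↑ʳ {m} {n} i j eq
  with trans (sym (Fin.splitAt-↑ˡ m i n)) (trans (cong (splitAt m) eq) (Fin.splitAt-↑ʳ m n j))
... | ()

↑ˡ-<ᵇ : ∀ {a} (r : Fin a) b → (toℕ (r ↑ˡ b) <ᵇ a) ≡ true
↑ˡ-<ᵇ zero    b = refl
↑ˡ-<ᵇ (suc r) b = ↑ˡ-<ᵇ r b

↑ʳ-<ᵇ : ∀ a {b} (c : Fin b) → (toℕ (a ↑ʳ c) <ᵇ a) ≡ false
↑ʳ-<ᵇ zero    c = refl
↑ʳ-<ᵇ (suc a) c = ↑ʳ-<ᵇ a c

TDSOfLength : Graph → ℕ → Set
TDSOfLength H k = Σ[ S ∈ List (V H) ] (Unique S × IsTDS H S × length S ≡ k)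

record RookCover (a b : ℕ) (I : Set) : Set where
  field
    row            : I → Fin a
    col            : I → Fin b
    cell-injective : ∀ {i j} → row i ≡ row j → col i ≡ col j → i ≡ j
    row-covered    : ∀ r → ∃[ i ] row i ≡ r
    col-covered    : ∀ c → ∃[ i ] col i ≡ c
    partner        : ∀ i → ∃[ j ] (j ≢ i × (row j ≡ row i ⊎ col j ≡ col i))

module Grid (a b : ℕ) where

  open Edges (K a b) public

  gridEdge : Fin a → Fin b → Edge (K a b)
  gridEdge r c = r ↑ˡ b , a ↑ʳ c , ordered , subst T (sym across) tt
    where
      ordered : toℕ (r ↑ˡ b) < toℕ (a ↑ʳ c)
      ordered = subst₂ _<_ (sym (Fin.toℕ-↑ˡ r b)) (sym (Fin.toℕ-↑ʳ a c))
                  (<-≤-trans (Fin.toℕ<n r) (m≤m+n a (toℕ c)))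
      across : adj (K a b) (r ↑ˡ b) (a ↑ʳ c) ≡ true
      across = cong₂ _xor_ (↑ˡ-<ᵇ r b) (↑ʳ-<ᵇ a c)

  gridEdge-injective : ∀ {r r′ c c′} → gridEdge r c ≡ gridEdge r′ c′ → r ≡ r′ × c ≡ c′
  gridEdge-injective eq = Fin.↑ˡ-injective b _ _ (cong src eq) , Fin.↑ʳ-injective a _ _ (cong tgt eq)

  gridEdge-surjective : ∀ e → ∃[ r ] ∃[ c ] gridEdge r c ≡ e
  gridEdge-surjective (u , w , u<w , t) with side a b u | side a b w
  ... | left r  | right c  = r , c , edge-ext refl refl
  ... | left r  | left r′  = ⊥-elim (subst T (cong₂ _xor_ (↑ˡ-<ᵇ r b) (↑ˡ-<ᵇ r′ b)) t)
  ... | right c | right c′ = ⊥-elim (subst T (cong₂ _xor_ (↑ʳ-<ᵇ a c) (↑ʳ-<ᵇ a c′)) t)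
  ... | right c | left r   = ⊥-elim (<⇒≱ (subst₂ _<_ (Fin.toℕ-↑ʳ a c) (Fin.toℕ-↑ˡ r b) u<w)
                                          (≤-trans (<⇒≤ (Fin.toℕ<n r)) (m≤m+n a (toℕ c))))

  sameRow-adjacent : ∀ {r r′ c c′} → r ≡ r′ → c ≢ c′ →
                     MAdj (K a b) (inj₂ (gridEdge r c)) (inj₂ (gridEdge r′ c′))
  sameRow-adjacent refl c≢c′ = c≢c′ ∘ proj₂ ∘ gridEdge-injective , _ , inj₁ refl , inj₁ refl

  sameCol-adjacent : ∀ {r r′ c c′} → c ≡ c′ → r ≢ r′ →
                     MAdj (K a b) (inj₂ (gridEdge r c)) (inj₂ (gridEdge r′ c′))
  sameCol-adjacent refl r≢r′ = r≢r′ ∘ proj₁ ∘ gridEdge-injective , _ , inj₂ refl , inj₂ refl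

  rookCover-tds : ∀ {I m} → RookCover a b I → Fin m ↔ I → TDSOfLength (Middle (K a b)) m
  rookCover-tds {I} R enum = S , tabulate⁺ (↔-injective enum ∘ cell-injective′ ∘ inj₂-injective) ,
                             dominating , length-tabulate _
    where
      open RookCover R
      open Inverse enum using (to; from; strictlyInverseˡ)

      cell : I → Edge (K a b)
      cell i = gridEdge (row i) (col i)

      cell-injective′ : ∀ {i j} → cell i ≡ cell j → i ≡ j
      cell-injective′ = uncurry cell-injective ∘ gridEdge-injective

      S : List (Fin (a + b) ⊎ Edge (K a b))
      S = tabulate (inj₂ ∘ cell ∘ to)

      cell∈S : ∀ i → inj₂ (cell i) ∈ S
      cell∈S i = subst (λ j → inj₂ (cell j) ∈ S) (strictlyInverseˡ i) (∈-tabulate⁺ (from i))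

      edge-dominated : ∀ r c → ∃[ u ] (u ∈ S × MAdj (K a b) (inj₂ (gridEdge r c)) u)
      edge-dominated r c with col-covered c
      ... | i , refl with row i Fin.≟ r
      ...   | no row≢r = inj₂ (cell i) , cell∈S i , sameCol-adjacent refl (row≢r ∘ sym)
      ...   | yes refl with partner i
      ...     | j , j≢i , inj₁ row≡ = inj₂ (cell j) , cell∈S j ,
                sameRow-adjacent (sym row≡) (λ col≡ → j≢i (cell-injective row≡ (sym col≡)))
      ...     | j , j≢i , inj₂ col≡ = inj₂ (cell j) , cell∈S j ,
                sameCol-adjacent (sym col≡) (λ row≡ → j≢i (cell-injective (sym row≡) col≡))

      dominating : IsTDS (Middle (K a b)) S
      dominating (inj₁ v) with side a b v
      ... | left r with row-covered r
      ...   | i , refl = inj₂ (cell i) , cell∈S i , inj₁ refl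
      dominating (inj₁ v) | right c with col-covered c
      ...   | i , refl = inj₂ (cell i) , cell∈S i , inj₂ refl
      dominating (inj₂ e) with gridEdge-surjective e
      ... | r , c , refl = edge-dominated r c

-- Vertical dominoes fill the first q columns and rows 0 … 2q-1, horizontal dominoes fill the next
-- 2A columns and the remaining A rows, and the last R columns get one cell each in the row r₀.
module Layout (q A R : ℕ) where

  Domino : Set
  Domino = (Fin q × Fin 2) ⊎ (Fin A × Fin 2)

  Cell : Set
  Cell = Domino ⊎ Fin R

  dominoRow : Domino → Fin (q * 2 + A)
  dominoRow (inj₁ (j , t)) = combine j t ↑ˡ A
  dominoRow (inj₂ (s , _)) = (q * 2) ↑ʳ s

  dominoCol : Domino → Fin (q + A * 2)
  dominoCol (inj₁ (j , _)) = j ↑ˡ (A * 2)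
  dominoCol (inj₂ (s , t)) = q ↑ʳ combine s t

  domino-injective : ∀ {d d′} → dominoRow d ≡ dominoRow d′ → dominoCol d ≡ dominoCol d′ → d ≡ d′
  domino-injective {inj₁ (j , t)} {inj₁ (j′ , t′)} row≡ _
    with Fin.combine-injective j t j′ t′ (Fin.↑ˡ-injective A _ _ row≡)
  ... | refl , refl = refl
  domino-injective {inj₂ (s , t)} {inj₂ (s′ , t′)} _ col≡
    with Fin.combine-injective s t s′ t′ (Fin.↑ʳ-injective q _ _ col≡)
  ... | refl , refl = refl
  domino-injective {inj₁ _} {inj₂ _} _ col≡ = ⊥-elim (↑ˡ≢↑ʳ _ _ col≡)
  domino-injective {inj₂ _} {inj₁ _} _ col≡ = ⊥-elim (↑ˡ≢↑ʳ _ _ (sym col≡))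

  dominoRow-surjective : ∀ r → ∃[ d ] dominoRow d ≡ r
  dominoRow-surjective r with side (q * 2) A r
  ... | left k with Fin.combine-surjective {q} {2} k
  ...   | j , t , refl = inj₁ (j , t) , refl
  dominoRow-surjective r | right s = inj₂ (s , 0F) , refl

  enumeration : Fin (q * 2 + A * 2 + R) ↔ Cell
  enumeration =
    ((Fin.*↔× ⊎-↔ Fin.*↔×) ⊎-↔ ↔-id (Fin R)) ↔-∘ ((Fin.+↔⊎ ⊎-↔ ↔-id (Fin R)) ↔-∘ Fin.+↔⊎)

  col : Cell → Fin (q + A * 2 + R)
  col (inj₁ d) = dominoCol d ↑ˡ R
  col (inj₂ c) = (q + A * 2) ↑ʳ c

  col-surjective : ∀ c → ∃[ i ] col i ≡ c
  col-surjective c with side (q + A * 2) R c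
  ... | right c′ = inj₂ c′ , refl
  ... | left x with side q (A * 2) x
  ...   | left j = inj₁ (inj₁ (j , 0F)) , refl
  ...   | right k with Fin.combine-surjective {A} {2} k
  ...     | s , t , refl = inj₁ (inj₂ (s , t)) , refl

  module _ (r₀ : Fin (q * 2 + A)) where

    row : Cell → Fin (q * 2 + A)
    row (inj₁ d) = dominoRow d
    row (inj₂ _) = r₀

    cell-injective : ∀ {i j} → row i ≡ row j → col i ≡ col j → i ≡ j
    cell-injective {inj₁ _} {inj₁ _} row≡ col≡ =
      cong inj₁ (domino-injective row≡ (Fin.↑ˡ-injective R _ _ col≡))
    cell-injective {inj₂ _} {inj₂ _} _ col≡ = cong inj₂ (Fin.↑ʳ-injective (q + A * 2) _ _ col≡)
    cell-injective {inj₁ _} {inj₂ _} _ col≡ = ⊥-elim (↑ˡ≢↑ʳ _ _ col≡)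
    cell-injective {inj₂ _} {inj₁ _} _ col≡ = ⊥-elim (↑ˡ≢↑ʳ _ _ (sym col≡))

    row-surjective : ∀ r → ∃[ i ] row i ≡ r
    row-surjective r with dominoRow-surjective r
    ... | d , eq = inj₁ d , eq

    partner : ∀ i → ∃[ j ] (j ≢ i × (row j ≡ row i ⊎ col j ≡ col i))
    partner (inj₁ (inj₁ (j , 0F))) = inj₁ (inj₁ (j , 1F)) , (λ ()) , inj₂ refl
    partner (inj₁ (inj₁ (j , 1F))) = inj₁ (inj₁ (j , 0F)) , (λ ()) , inj₂ refl
    partner (inj₁ (inj₂ (s , 0F))) = inj₁ (inj₂ (s , 1F)) , (λ ()) , inj₁ refl
    partner (inj₁ (inj₂ (s , 1F))) = inj₁ (inj₂ (s , 0F)) , (λ ()) , inj₁ refl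
    partner (inj₂ _) with dominoRow-surjective r₀
    ... | d , eq = inj₁ d , (λ ()) , inj₁ eq

    rookCover : RookCover (q * 2 + A) (q + A * 2 + R) Cell
    rookCover = record
      { row            = row
      ; col            = col
      ; cell-injective = cell-injective
      ; row-covered    = row-surjective
      ; col-covered    = col-surjective
      ; partner        = partner
      }

completeBipartite-upperBound : ∀ {n₁ n₂} q A R → q * 2 + A ≡ n₁ → q + A * 2 + R ≡ n₂ → 0 < n₁ →
                               TDSOfLength (Middle (K n₁ n₂)) (n₂ + q)
completeBipartite-upperBound q A R refl refl 0<n₁ =
  subst (TDSOfLength _) (cellCount q A R)
        (Grid.rookCover-tds _ _ (Layout.rookCover q A R (Fin.fromℕ< 0<n₁)) (Layout.enumeration q A R))
  where
    cellCount : ∀ q A R → q * 2 + A * 2 + R ≡ q + A * 2 + R + q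
    cellCount = solve-∀

completeBipartite-lowerBounds : ∀ a b S → IsTDS (Middle (K a b)) S →
                                (a + b) * 2 ≤ length S * 3 × b ≤ length S
completeBipartite-lowerBounds a b S tds =
  n*2≤length*3 ,
  independent⇒≤length (a ↑ʳ_) (Fin.↑ʳ-injective a _ _) (λ i j → cong₂ _xor_ (↑ʳ-<ᵇ a i) (↑ʳ-<ᵇ a j))
  where open MiddleTDS (K a b) S tds

ceil3*3≤m+2 : ∀ c → ceil3 c * 3 ≤ c + 2
ceil3*3≤m+2 c = m/n*n≤m (c + 2) 3

m≤ceil3*3 : ∀ c → c ≤ ceil3 c * 3
m≤ceil3*3 c = +-cancelʳ-≤ 2 c (ceil3 c * 3) (begin
  c + 2                       ≡⟨ m≡m%n+[m/n]*n (c + 2) 3 ⟩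
  (c + 2) % 3 + ceil3 c * 3   ≤⟨ +-monoˡ-≤ (ceil3 c * 3) (s≤s⁻¹ (m%n<n (c + 2) 3)) ⟩
  2 + ceil3 c * 3             ≡⟨ +-comm 2 (ceil3 c * 3) ⟩
  ceil3 c * 3 + 2             ∎)
  where open ≤-Reasoning

m≤n*3⇒ceil3≤n : ∀ {c d} → c ≤ d * 3 → ceil3 c ≤ d
m≤n*3⇒ceil3≤n {c} {d} c≤3d = s≤s⁻¹ (m<n*o⇒m/o<n (begin-strict
  c + 2      <⟨ +-monoʳ-< c ≤-refl ⟩
  c + 3      ≤⟨ +-monoˡ-≤ 3 c≤3d ⟩
  d * 3 + 3  ≡⟨ +-comm (d * 3) 3 ⟩
  suc d * 3  ∎))
  where open ≤-Reasoning

b+ceil3[2a∸b]≤L : ∀ {a b L} → (a + b) * 2 ≤ L * 3 → b ≤ L → b + ceil3 (2 * a ∸ b) ≤ L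
b+ceil3[2a∸b]≤L {a} {b} {L} bound b≤L = begin
  b + ceil3 (2 * a ∸ b)  ≤⟨ +-monoʳ-≤ b (m≤n*3⇒ceil3≤n (m≤n+o⇒m∸n≤o (2 * a) b 2a≤b+3d)) ⟩
  b + d                  ≡⟨ m+[n∸m]≡n b≤L ⟩
  L                      ∎
  where
    open ≤-Reasoning
    d = L ∸ b
    2a≤b+3d : 2 * a ≤ b + d * 3
    2a≤b+3d = +-cancelˡ-≤ (b * 2) _ _ (begin
      b * 2 + 2 * a        ≡⟨ doubled a b ⟩
      (a + b) * 2          ≤⟨ bound ⟩
      L * 3                ≡⟨ cong (_* 3) (m+[n∸m]≡n b≤L) ⟨
      (b + d) * 3          ≡⟨ tripled b d ⟩
      b * 2 + (b + d * 3)  ∎)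
      where
        doubled : ∀ a b → b * 2 + 2 * a ≡ (a + b) * 2
        doubled = solve-∀
        tripled : ∀ b d → (b + d) * 3 ≡ b * 2 + (b + d * 3)
        tripled = solve-∀

q*3≤n+2⇒q*2≤n : ∀ q {n} → 2 ≤ n → q * 3 ≤ n + 2 → q * 2 ≤ n
q*3≤n+2⇒q*2≤n 0 _ _ = z≤n
q*3≤n+2⇒q*2≤n 1 2≤n _ = 2≤n
q*3≤n+2⇒q*2≤n q@(suc (suc _)) {n} _ 3q≤n+2 = +-cancelʳ-≤ 2 (q * 2) n (begin
  q * 2 + 2  ≤⟨ +-monoʳ-≤ (q * 2) (s≤s (s≤s z≤n)) ⟩
  q * 2 + q  ≡⟨ trans (+-comm (q * 2) q) (sym (*-suc q 2)) ⟩
  q * 3      ≤⟨ 3q≤n+2 ⟩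
  n + 2      ∎)
  where open ≤-Reasoning

layout-parameters : ∀ {n₁ n₂} → 2 ≤ n₁ → n₁ ≤ n₂ → n₂ ≤ 2 * n₁ →
  let q = ceil3 (2 * n₁ ∸ n₂) in ∃[ A ] ∃[ R ] (q * 2 + A ≡ n₁ × q + A * 2 + R ≡ n₂)
layout-parameters {n₁} {n₂} 2≤n₁ n₁≤n₂ n₂≤2n₁ =
  A , n₂ ∸ (q + A * 2) , q*2+A≡n₁ , m+[n∸m]≡n q+2A≤n₂
  where
    open ≤-Reasoning
    c = 2 * n₁ ∸ n₂
    q = ceil3 c
    c≤n₁ : c ≤ n₁
    c≤n₁ = begin
      2 * n₁ ∸ n₂  ≤⟨ ∸-monoʳ-≤ (2 * n₁) n₁≤n₂ ⟩
      2 * n₁ ∸ n₁  ≡⟨ m+n∸m≡n n₁ (n₁ + 0) ⟩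
      n₁ + 0       ≡⟨ +-identityʳ n₁ ⟩
      n₁           ∎
    A = n₁ ∸ q * 2
    q*2+A≡n₁ : q * 2 + A ≡ n₁
    q*2+A≡n₁ = m+[n∸m]≡n (q*3≤n+2⇒q*2≤n q 2≤n₁ (≤-trans (ceil3*3≤m+2 c) (+-monoˡ-≤ 2 c≤n₁)))
    q+2A≤n₂ : q + A * 2 ≤ n₂
    q+2A≤n₂ = +-cancelʳ-≤ (q * 3) (q + A * 2) n₂ (begin
      q + A * 2 + q * 3   ≡⟨ regroup q A ⟩
      (q * 2 + A) * 2     ≡⟨ cong (_* 2) q*2+A≡n₁ ⟩
      n₁ * 2              ≡⟨ *-comm n₁ 2 ⟩
      2 * n₁              ≡⟨ m+[n∸m]≡n n₂≤2n₁ ⟨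
      n₂ + c              ≤⟨ +-monoʳ-≤ n₂ (m≤ceil3*3 c) ⟩
      n₂ + q * 3          ∎)
      where
        regroup : ∀ q A → q + A * 2 + q * 3 ≡ (q * 2 + A) * 2
        regroup = solve-∀

proposition2p15 : (n1 n2 : ℕ) → 2 ≤ n1 → n1 ≤ n2 →
    ((n2 ≤ 2 * n1 ∸ 1) → TotalDominationNumber (Middle (K n1 n2)) (n2 + ceil3 (2 * n1 ∸ n2)))
    × ((2 * n1 ≤ n2) → TotalDominationNumber (Middle (K n1 n2)) n2)
proposition2p15 n1 n2 2≤n1 n1≤n2 = small , large
  where
    0<n1 : 0 < n1
    0<n1 = ≤-trans (s≤s z≤n) 2≤n1

    small : n2 ≤ 2 * n1 ∸ 1 → TotalDominationNumber (Middle (K n1 n2)) (n2 + ceil3 (2 * n1 ∸ n2))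
    small n2<2n1 with layout-parameters 2≤n1 n1≤n2 (≤-trans n2<2n1 (m∸n≤m (2 * n1) 1))
    ... | A , R , rows , cols =
      completeBipartite-upperBound (ceil3 (2 * n1 ∸ n2)) A R rows cols 0<n1 ,
      λ S _ tds → uncurry (b+ceil3[2a∸b]≤L {n1}) (completeBipartite-lowerBounds n1 n2 S tds)

    large : 2 * n1 ≤ n2 → TotalDominationNumber (Middle (K n1 n2)) n2
    large 2n1≤n2 =
      subst (TDSOfLength _) (+-identityʳ n2) (completeBipartite-upperBound 0 n1 (n2 ∸ n1 * 2) refl cols 0<n1) ,
      λ S _ tds → proj₂ (completeBipartite-lowerBounds n1 n2 S tds)
      where
        cols : n1 * 2 + (n2 ∸ n1 * 2) ≡ n2
        cols = m+[n∸m]≡n (subst (_≤ n2) (*-comm 2 n1) 2n1≤n2)
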